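{- Let $\pi^\varepsilon$ be a clean compact peg permutation of length $n$ whose last entry does not have value $n$. Then $prd(\pi^\varepsilon)\geq n$.
   Context: A peg permutation of length $n$ is a word $\pi_1^{\varepsilon_1}\cdots\pi_n^{\varepsilon_n}$ with $\pi_1\cdots\pi_n$ a permutation of $\{1,\dots,n\}$ in one-line notation and $\varepsilon_i\in\{+,-,\bullet\}$. An increasing (resp. decreasing) strip is a maximal factor of consecutive positions in which each value is one more (resp. one less) than the previous and all entries are decorated $+$ or $\bullet$ (resp. $-$ or $\bullet$); clean compact means all strips have length $1$. A prefix reversal reverses a prefix $\pi_1\cdots\pi_j$ and swaps $+\leftrightarrow-$ on the reversed entries ($\bullet$ unchanged); $prd(\pi^\varepsilon)$ is the minimum number of prefix reversals turning $\pi^\varepsilon$ into a peg permutation with identity underlying permutation and all decorations in $\{+,\bullet\}$. -}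

module Defs where

open import Data.Nat using (ℕ; zero; suc; _≤_; _+_)
open import Data.Product using (_×_; _,_; proj₁; proj₂)
open import Data.Sum using (_⊎_)
open import Data.List using (List; []; _∷_; _++_; map; take; drop; reverse; upTo; length)
open import Data.List.Relation.Unary.All using (All)
open import Data.List.Relation.Binary.Permutation.Propositional using (_↭_)
open import Relation.Binary.PropositionalEquality using (_≡_)
open import Relation.Nullary using (¬_)
open import Data.Unit using (⊤)

data Sign : Set where
  plus minus dot : Sign

PegWord : Set
PegWord = List (ℕ × Sign)

oneTo : ℕ → List ℕ
oneTo n = map suc (upTo n)

IsPegPerm : ℕ → PegWord → Set
IsPegPerm n w = map proj₁ w ↭ oneTo n

-- decoration allowed in an increasing strip (+ or •) / decreasing strip (- or •)
IncDec : Sign → Set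
IncDec s = s ≡ plus ⊎ s ≡ dot

DecDec : Sign → Set
DecDec s = s ≡ minus ⊎ s ≡ dot

SameStrip : ℕ × Sign → ℕ × Sign → Set
SameStrip (a , e) (b , f) =
  (b ≡ suc a × IncDec e × IncDec f) ⊎ (a ≡ suc b × DecDec e × DecDec f)

-- every strip has length 1: no two consecutive entries lie in a common strip
CleanCompact : PegWord → Set
CleanCompact [] = ⊤
CleanCompact (x ∷ []) = ⊤
CleanCompact (x ∷ y ∷ w) = ¬ SameStrip x y × CleanCompact (y ∷ w)

flipSign : Sign → Sign
flipSign plus = minus
flipSign minus = plus
flipSign dot = dot

flipEntry : ℕ × Sign → ℕ × Sign
flipEntry (v , s) = (v , flipSign s)

prefixReversal : ℕ → PegWord → PegWord
prefixReversal j w = map flipEntry (reverse (take j w)) ++ drop j w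

applyReversals : List ℕ → PegWord → PegWord
applyReversals [] w = w
applyReversals (j ∷ js) w = applyReversals js (prefixReversal j w)

ValidReversals : ℕ → List ℕ → Set
ValidReversals n js = All (λ j → 1 ≤ j × j ≤ n) js

IsSortedPeg : ℕ → PegWord → Set
IsSortedPeg n w = map proj₁ w ≡ oneTo n × All (λ x → IncDec (proj₂ x)) w

PrdAtLeast : ℕ → PegWord → ℕ → Set
PrdAtLeast n w k =
  (js : List ℕ) → ValidReversals n js → IsSortedPeg n (applyReversals js w) → k ≤ length js

module Submission where

open import Defs
open import Data.Nat using (ℕ; suc; _+_; _≤_; _≟_; z≤n; s≤s)
open import Data.Nat.Properties
open import Data.Bool using (true; false; if_then_else_)
open import Data.Product using (_×_; _,_; proj₁; proj₂)
open import Data.Sum using (inj₁; inj₂)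
open import Data.List using ([]; _∷_; _++_; _∷ʳ_; map; take; drop; reverse; length; applyUpTo; _ʳ++_; upTo)
open import Data.List.Properties using (length-map; length-upTo; ++-assoc; take++drop≡id; map-++; map-applyUpTo; applyUpTo-∷ʳ)
open import Data.List.Relation.Unary.All using (All; []; _∷_)
open import Data.List.Relation.Unary.All.Properties using (∷ʳ⁺)
open import Data.List.Relation.Unary.Linked using (Linked; []; [-]; _∷_)
open import Data.List.Relation.Unary.Linked.Properties using (map⁻; applyUpTo⁺₂)
open import Function using (_∘_)
open import Function.Bundles using (mk⇔)
open import Relation.Binary.PropositionalEquality
open import Relation.Nullary using (Dec; yes; no; ¬_; does; _×-dec_; _⊎-dec_)
open import Relation.Nullary.Decidable using (dec-true; dec-false; does-⇔)

-- Count the adjacencies (consecutive entries lying in a common strip) of the word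
-- followed by a sentinel (n+1)⁺.  Reversing and flipping a block maps strips to
-- strips, so a prefix reversal keeps the adjacencies inside the reversed block and
-- inside the rest, and can only create one at the single cut: it gains at most one
-- adjacency.  A clean compact word whose last value is not n starts with none,
-- while the sorted word has n, one between any two consecutive values up to n+1.

incDec? : (s : Sign) → Dec (IncDec s)
incDec? plus  = yes (inj₁ refl)
incDec? minus = no λ { (inj₁ ()) ; (inj₂ ()) }
incDec? dot   = yes (inj₂ refl)

decDec? : (s : Sign) → Dec (DecDec s)
decDec? plus  = no λ { (inj₁ ()) ; (inj₂ ()) }
decDec? minus = yes (inj₁ refl)
decDec? dot   = yes (inj₂ refl)

sameStrip? : (x y : ℕ × Sign) → Dec (SameStrip x y)
sameStrip? (a , e) (b , f) =
  (b ≟ suc a ×-dec incDec? e ×-dec incDec? f) ⊎-dec (a ≟ suc b ×-dec decDec? e ×-dec decDec? f)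

flipSign-involutive : (s : Sign) → flipSign (flipSign s) ≡ s
flipSign-involutive plus  = refl
flipSign-involutive minus = refl
flipSign-involutive dot   = refl

flipEntry-involutive : (x : ℕ × Sign) → flipEntry (flipEntry x) ≡ x
flipEntry-involutive (a , s) = cong (a ,_) (flipSign-involutive s)

incDec⇒decDec-flip : ∀ {s} → IncDec s → DecDec (flipSign s)
incDec⇒decDec-flip (inj₁ refl) = inj₁ refl
incDec⇒decDec-flip (inj₂ refl) = inj₂ refl

decDec⇒incDec-flip : ∀ {s} → DecDec s → IncDec (flipSign s)
decDec⇒incDec-flip (inj₁ refl) = inj₁ refl
decDec⇒incDec-flip (inj₂ refl) = inj₂ refl

sameStrip-flip : ∀ {x y} → SameStrip x y → SameStrip (flipEntry y) (flipEntry x)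
sameStrip-flip (inj₁ (b≡1+a , ie , if)) = inj₂ (b≡1+a , incDec⇒decDec-flip if , incDec⇒decDec-flip ie)
sameStrip-flip (inj₂ (a≡1+b , de , df)) = inj₁ (a≡1+b , decDec⇒incDec-flip df , decDec⇒incDec-flip de)

sameStrip-unflip : ∀ {x y} → SameStrip (flipEntry y) (flipEntry x) → SameStrip x y
sameStrip-unflip {x} {y} s =
  subst₂ SameStrip (flipEntry-involutive x) (flipEntry-involutive y) (sameStrip-flip s)

adjacency : ℕ × Sign → ℕ × Sign → ℕ
adjacency x y = if does (sameStrip? x y) then 1 else 0

adjacencies : PegWord → ℕ
adjacencies []          = 0
adjacencies (x ∷ [])    = 0
adjacencies (x ∷ y ∷ w) = adjacency x y + adjacencies (y ∷ w)

adjacency≤1 : ∀ x y → adjacency x y ≤ 1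
adjacency≤1 x y with does (sameStrip? x y)
... | true  = ≤-refl
... | false = z≤n

adjacency-flip : ∀ x y → adjacency (flipEntry y) (flipEntry x) ≡ adjacency x y
adjacency-flip x y =
  cong (if_then 1 else 0) (does-⇔ (mk⇔ sameStrip-unflip sameStrip-flip) (sameStrip? _ _) (sameStrip? x y))

adjacencies-flip-ʳ++ : ∀ p a acc →
  adjacencies (map flipEntry (p ʳ++ (a ∷ acc))) ≡ adjacencies (a ∷ p) + adjacencies (map flipEntry (a ∷ acc))
adjacencies-flip-ʳ++ []      a acc = refl
adjacencies-flip-ʳ++ (b ∷ p) a acc = begin
    adjacencies (map flipEntry (p ʳ++ (b ∷ a ∷ acc)))
  ≡⟨ adjacencies-flip-ʳ++ p b (a ∷ acc) ⟩
    adjacencies (b ∷ p) + (adjacency (flipEntry b) (flipEntry a) + rest)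
  ≡⟨ cong (λ k → adjacencies (b ∷ p) + (k + rest)) (adjacency-flip a b) ⟩
    adjacencies (b ∷ p) + (adjacency a b + rest)
  ≡⟨ sym (+-assoc (adjacencies (b ∷ p)) (adjacency a b) rest) ⟩
    adjacencies (b ∷ p) + adjacency a b + rest
  ≡⟨ cong (_+ rest) (+-comm (adjacencies (b ∷ p)) (adjacency a b)) ⟩
    adjacency a b + adjacencies (b ∷ p) + rest
  ∎
  where
    open ≡-Reasoning
    rest = adjacencies (map flipEntry (a ∷ acc))

adjacencies-flip-reverse : ∀ p → adjacencies (map flipEntry (reverse p)) ≡ adjacencies p
adjacencies-flip-reverse []      = refl
adjacencies-flip-reverse (x ∷ p) = trans (adjacencies-flip-ʳ++ p x []) (+-identityʳ _)

adjacencies-++-≤ : ∀ xs ys → adjacencies (xs ++ ys) ≤ suc (adjacencies xs + adjacencies ys)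
adjacencies-++-≤ []           ys       = n≤1+n _
adjacencies-++-≤ (x ∷ [])     []       = z≤n
adjacencies-++-≤ (x ∷ [])     (y ∷ ys) = +-monoˡ-≤ (adjacencies (y ∷ ys)) (adjacency≤1 x y)
adjacencies-++-≤ (x ∷ y ∷ xs) ys       = begin
    adjacency x y + adjacencies (y ∷ xs ++ ys)
  ≤⟨ +-monoʳ-≤ (adjacency x y) (adjacencies-++-≤ (y ∷ xs) ys) ⟩
    adjacency x y + suc (adjacencies (y ∷ xs) + adjacencies ys)
  ≡⟨ +-suc (adjacency x y) _ ⟩
    suc (adjacency x y + (adjacencies (y ∷ xs) + adjacencies ys))
  ≡⟨ cong suc (sym (+-assoc (adjacency x y) _ _)) ⟩
    suc (adjacency x y + adjacencies (y ∷ xs) + adjacencies ys)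
  ∎
  where open ≤-Reasoning

adjacencies-++-≥ : ∀ xs ys → adjacencies xs + adjacencies ys ≤ adjacencies (xs ++ ys)
adjacencies-++-≥ []           ys       = ≤-refl
adjacencies-++-≥ (x ∷ [])     []       = z≤n
adjacencies-++-≥ (x ∷ [])     (y ∷ ys) = m≤n+m _ _
adjacencies-++-≥ (x ∷ y ∷ xs) ys       = begin
    adjacency x y + adjacencies (y ∷ xs) + adjacencies ys
  ≡⟨ +-assoc (adjacency x y) _ _ ⟩
    adjacency x y + (adjacencies (y ∷ xs) + adjacencies ys)
  ≤⟨ +-monoʳ-≤ (adjacency x y) (adjacencies-++-≥ (y ∷ xs) ys) ⟩
    adjacency x y + adjacencies (y ∷ xs ++ ys)
  ∎
  where open ≤-Reasoning

adjacencies-prefixReversal : ∀ j w r →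
  adjacencies (prefixReversal j w ++ r) ≤ suc (adjacencies (w ++ r))
adjacencies-prefixReversal j w r = begin
    adjacencies (prefixReversal j w ++ r)
  ≡⟨ cong adjacencies (++-assoc (map flipEntry (reverse p)) (drop j w) r) ⟩
    adjacencies (map flipEntry (reverse p) ++ s)
  ≤⟨ adjacencies-++-≤ (map flipEntry (reverse p)) s ⟩
    suc (adjacencies (map flipEntry (reverse p)) + adjacencies s)
  ≡⟨ cong (λ k → suc (k + adjacencies s)) (adjacencies-flip-reverse p) ⟩
    suc (adjacencies p + adjacencies s)
  ≤⟨ s≤s (adjacencies-++-≥ p s) ⟩
    suc (adjacencies (p ++ s))
  ≡⟨ cong (suc ∘ adjacencies) (sym (++-assoc p (drop j w) r)) ⟩
    suc (adjacencies ((p ++ drop j w) ++ r))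
  ≡⟨ cong (λ xs → suc (adjacencies (xs ++ r))) (take++drop≡id j w) ⟩
    suc (adjacencies (w ++ r))
  ∎
  where
    open ≤-Reasoning
    p = take j w
    s = drop j w ++ r

adjacencies-applyReversals : ∀ js w r →
  adjacencies (applyReversals js w ++ r) ≤ length js + adjacencies (w ++ r)
adjacencies-applyReversals []       w r = ≤-refl
adjacencies-applyReversals (j ∷ js) w r = begin
    adjacencies (applyReversals js (prefixReversal j w) ++ r)
  ≤⟨ adjacencies-applyReversals js (prefixReversal j w) r ⟩
    length js + adjacencies (prefixReversal j w ++ r)
  ≤⟨ +-monoʳ-≤ (length js) (adjacencies-prefixReversal j w r) ⟩
    length js + suc (adjacencies (w ++ r))
  ≡⟨ +-suc (length js) _ ⟩
    suc (length js + adjacencies (w ++ r))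
  ∎
  where open ≤-Reasoning

adjacency-sameStrip : ∀ {x y} → SameStrip x y → adjacency x y ≡ 1
adjacency-sameStrip {x} {y} s rewrite dec-true (sameStrip? x y) s = refl

adjacency-¬sameStrip : ∀ {x y} → ¬ SameStrip x y → adjacency x y ≡ 0
adjacency-¬sameStrip {x} {y} ¬s rewrite dec-false (sameStrip? x y) ¬s = refl

adjacencies-linked : ∀ w x → Linked SameStrip (w ∷ʳ x) → adjacencies (w ∷ʳ x) ≡ length w
adjacencies-linked []           x _          = refl
adjacencies-linked (y ∷ [])     x (s ∷ [-])  = cong (_+ 0) (adjacency-sameStrip s)
adjacencies-linked (y ∷ z ∷ zs) x (s ∷ rest) =
  cong₂ _+_ (adjacency-sameStrip s) (adjacencies-linked (z ∷ zs) x rest)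

adjacencies-unlinked : ∀ {w} → Linked (λ x y → ¬ SameStrip x y) w → adjacencies w ≡ 0
adjacencies-unlinked []          = refl
adjacencies-unlinked [-]         = refl
adjacencies-unlinked (¬s ∷ rest) = cong₂ _+_ (adjacency-¬sameStrip ¬s) (adjacencies-unlinked rest)

cleanCompact⇒linked : ∀ w → CleanCompact w → Linked (λ x y → ¬ SameStrip x y) w
cleanCompact⇒linked []          _           = []
cleanCompact⇒linked (x ∷ [])    _           = [-]
cleanCompact⇒linked (x ∷ y ∷ w) (¬s , rest) = ¬s ∷ cleanCompact⇒linked (y ∷ w) rest

linked-∷ʳ : ∀ {A : Set} {R : A → A → Set} xs {x y} →
  Linked R (xs ∷ʳ x) → R x y → Linked R (xs ∷ʳ x ∷ʳ y)
linked-∷ʳ []            [-]         r = r ∷ [-]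
linked-∷ʳ (z ∷ [])      (r′ ∷ [-])  r = r′ ∷ r ∷ [-]
linked-∷ʳ (z ∷ z′ ∷ zs) (r′ ∷ rest) r = r′ ∷ linked-∷ʳ (z′ ∷ zs) rest r

increasing⇒linkedSameStrip : ∀ {w} → Linked (λ x y → proj₁ y ≡ suc (proj₁ x)) w →
  All (IncDec ∘ proj₂) w → Linked SameStrip w
increasing⇒linkedSameStrip []          _                  = []
increasing⇒linkedSameStrip [-]         _                  = [-]
increasing⇒linkedSameStrip (eq ∷ rest) (ie ∷ incs@(if ∷ _)) =
  inj₁ (eq , ie , if) ∷ increasing⇒linkedSameStrip rest incs

sorted⇒linkedSameStrip : ∀ n w → IsSortedPeg n w → Linked SameStrip (w ∷ʳ (suc n , plus))
sorted⇒linkedSameStrip n w (values , incs) =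
  increasing⇒linkedSameStrip (map⁻ (subst (Linked (λ a b → b ≡ suc a)) (sym values′) consecutive))
                             (∷ʳ⁺ incs (inj₁ refl))
  where
    consecutive : Linked (λ a b → b ≡ suc a) (applyUpTo suc (suc n))
    consecutive = applyUpTo⁺₂ suc (suc n) (λ _ → refl)
    values′ : map proj₁ (w ∷ʳ (suc n , plus)) ≡ applyUpTo suc (suc n)
    values′ = begin
        map proj₁ (w ∷ʳ (suc n , plus))
      ≡⟨ map-++ proj₁ w _ ⟩
        map proj₁ w ∷ʳ suc n
      ≡⟨ cong (_∷ʳ suc n) (trans values (map-applyUpTo (λ i → i) suc n)) ⟩
        applyUpTo suc n ∷ʳ suc n
      ≡⟨ applyUpTo-∷ʳ suc n ⟩
        applyUpTo suc (suc n)
      ∎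
      where open ≡-Reasoning

length-sorted : ∀ n w → IsSortedPeg n w → length w ≡ n
length-sorted n w (values , _) = begin
    length w
  ≡⟨ sym (length-map proj₁ w) ⟩
    length (map proj₁ w)
  ≡⟨ cong length values ⟩
    length (oneTo n)
  ≡⟨ length-map suc (upTo n) ⟩
    length (upTo n)
  ≡⟨ length-upTo n ⟩
    n
  ∎
  where open ≡-Reasoning

lastEntry-¬sameStrip-sentinel : ∀ {n v} e → v ≢ n → ¬ SameStrip (v , e) (suc n , plus)
lastEntry-¬sameStrip-sentinel e v≢n (inj₁ (1+n≡1+v , _))   = v≢n (sym (suc-injective 1+n≡1+v))
lastEntry-¬sameStrip-sentinel e v≢n (inj₂ (_ , _ , inj₁ ()))
lastEntry-¬sameStrip-sentinel e v≢n (inj₂ (_ , _ , inj₂ ()))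

mainTheorem17 : (n : ℕ) (u : PegWord) (v : ℕ) (e : Sign)
    → IsPegPerm n (u ∷ʳ (v , e)) → CleanCompact (u ∷ʳ (v , e)) → v ≢ n
    → PrdAtLeast n (u ∷ʳ (v , e)) n
mainTheorem17 n u v e _ clean v≢n js _ sorted = begin
    n
  ≡⟨ sym (length-sorted n target sorted) ⟩
    length target
  ≡⟨ sym (adjacencies-linked target sentinel (sorted⇒linkedSameStrip n target sorted)) ⟩
    adjacencies (target ∷ʳ sentinel)
  ≤⟨ adjacencies-applyReversals js initial (sentinel ∷ []) ⟩
    length js + adjacencies (initial ∷ʳ sentinel)
  ≡⟨ cong (length js +_) (adjacencies-unlinked initialLinked) ⟩
    length js + 0
  ≡⟨ +-identityʳ (length js) ⟩
    length js
  ∎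
  where
    open ≤-Reasoning
    initial target : PegWord
    initial = u ∷ʳ (v , e)
    target = applyReversals js initial
    sentinel : ℕ × Sign
    sentinel = (suc n , plus)
    initialLinked : Linked (λ x y → ¬ SameStrip x y) (initial ∷ʳ sentinel)
    initialLinked = linked-∷ʳ u (cleanCompact⇒linked initial clean) (lastEntry-¬sameStrip-sentinel e v≢n)
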